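{- Let $K$ be a field, let $A\in K[X]$ be monic of degree $3$, and let $R(X)=-v(X-w)$ with $v,w\in K$, $v\neq 0$. Suppose that for all $h\in\mathbb Z$ we are given $d_h,e_h\in K$, with $P_h(X)=d_h(X+e_h)$, polynomials $Q_h\in K[X]$ of degree exactly $2$, and $a_h\in K[X]$, such that $$P_h+P_{h+1}+A=a_hQ_h\qquad\text{and}\qquad -Q_hQ_{h+1}=-R+P_{h+1}(A+P_{h+1}).$$ Let $(T_h)_{h\in\mathbb Z}$ be a sequence of nonzero elements of $K$ with $T_{h-1}T_{h+1}=d_hT_h^2$ for all $h$. Then for all $h$, $$T_{h-3}T_{h+3}=v^2\,T_{h-2}T_{h+2}-v^3A(w)\,T_h^2.$$
   Context: These relations are the data of the continued fraction expansion $\frac{Z+P_h}{Q_h}=a_h-\frac{\bar Z+P_{h+1}}{Q_{h+1}}$ of $(Z+P_0)/Q_0$, where $Z^2-AZ-R=0$ (genus $2$ case), with all partial quotients of degree $1$. -}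

module Defs where

open import Level using (_⊔_)
open import Algebra.Bundles using (CommutativeRing)
open import Data.Nat using (ℕ; zero; suc; _∸_; _<_)
open import Data.Product using (Σ; _×_)
open import Relation.Nullary using (¬_)

record IsField {c ℓ} (R : CommutativeRing c ℓ) : Set (c ⊔ ℓ) where
  open CommutativeRing R
  field
    0≉1     : ¬ (0# ≈ 1#)
    inverse : ∀ x → ¬ (x ≈ 0#) → Σ Carrier (λ y → x * y ≈ 1#)

-- Polynomials in K[X], represented by their coefficient sequences
-- (coefficient of X^n at index n).  Polynomial arithmetic on coefficients.
module PolyOps {c ℓ} (R : CommutativeRing c ℓ) where
  open CommutativeRing R

  Poly : Set c
  Poly = ℕ → Carrier

  IsPolynomial : Poly → Set ℓ
  IsPolynomial p = Σ ℕ (λ N → ∀ n → N < n → p n ≈ 0#)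

  sumUpTo : (ℕ → Carrier) → ℕ → Carrier
  sumUpTo f zero    = 0#
  sumUpTo f (suc n) = sumUpTo f n + f n

  _⊕_ : Poly → Poly → Poly
  (p ⊕ q) n = p n + q n

  _⊗_ : Poly → Poly → Poly
  (p ⊗ q) n = sumUpTo (λ i → p i * q (n ∸ i)) (suc n)

  ⊖_ : Poly → Poly
  (⊖ p) n = - (p n)

  _≋_ : Poly → Poly → Set ℓ
  p ≋ q = ∀ n → p n ≈ q n

  HasDegree : Poly → ℕ → Set ℓ
  HasDegree p d = ¬ (p d ≈ 0#) × (∀ n → d < n → p n ≈ 0#)

  MonicOfDegree : Poly → ℕ → Set ℓ
  MonicOfDegree p d = (p d ≈ 1#) × (∀ n → d < n → p n ≈ 0#)

  pow : Carrier → ℕ → Carrier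
  pow x zero    = 1#
  pow x (suc n) = pow x n * x

  evalDeg : ℕ → Poly → Carrier → Carrier
  evalDeg d p x = sumUpTo (λ i → p i * pow x i) (suc d)

  linear : Carrier → Carrier → Poly
  linear a b zero          = b
  linear a b (suc zero)    = a
  linear a b (suc (suc _)) = 0#

{-# OPTIONS --safe #-}
module Submission where

open import Defs
open import Algebra.Bundles using (CommutativeRing)
open import Data.Integer using (ℤ) renaming (_+_ to _+ℤ_; _-_ to _-ℤ_)
open import Data.Product using (_×_)
open import Relation.Nullary using (¬_)

open import Algebra.Solver.Ring.AlmostCommutativeRing
  using (AlmostCommutativeRing; fromCommutativeRing; _-Raw-AlmostCommutative⟶_)
import Data.Integer as Int
import Data.Integer.Properties as Intₚ
open import Data.Integer.Tactic.RingSolver using () renaming (solve-∀ to ℤ-solve-∀)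
open import Data.Maybe using (Maybe; just; nothing)
open import Data.Nat as ℕ using (ℕ; zero; suc; z≤n; s≤s; _<_; _∸_)
import Data.Nat.Properties as ℕ
open import Data.Product using (_,_; proj₂)
open import Data.Sign as Sign using (Sign)
open import Function using (_∘_)
open import Relation.Binary.Definitions using (tri<; tri≈; tri>)
open import Relation.Binary.PropositionalEquality as ≡ using (_≡_; _≢_)
open import Relation.Nullary using (yes; no; contradiction)

-- Write P h = d h (X + e h), Q h = q h X² + r h X + s h.  Comparing degrees in
-- P h + P (h+1) + A = a h Q h shows that a h = b h X + c h is linear, and comparing the
-- top coefficients of both relations shows that Q h + P (h+1) a (h+1) is a constant k h.
-- Eliminating Q h Q (h+1) between the relations then gives
--   k h Q (h+1) = R + P (h+1) P (h+2).
-- Its leading coefficient gives k h = q h q (h+1) q (h+2), so with q h q (h+1) = - d (h+1)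
-- we get k h k (h+1) = - d (h+1) d (h+2) d (h+3); evaluating it at the root - e (h+2) of
-- P (h+2) gives k h k (h+1) = v (w + e (h+2)).  Evaluating every relation at the root w
-- of R gives k h k (h+1) (A(w) + P (h+2)(w)) = - P (h+1)(w) P (h+2)(w) P (h+3)(w).
-- Together these yield
--   v² d (h-1) d h² d (h+1) - v³ A(w) = d (h-2) d (h-1)² d h³ d (h+1)² d (h+2),
-- and T (h-1) T (h+1) = d h T h² identifies the two products of d's with
-- T (h-2) T (h+2) / T h² and T (h-3) T (h+3) / T h².

module FieldProperties {ℓ₁ ℓ₂} (K : CommutativeRing ℓ₁ ℓ₂) (isField : IsField K) where
  open CommutativeRing K
  open IsField isField using (inverse)
  open import Relation.Binary.Reasoning.Setoid setoid

  *-cancelˡ : ∀ {x y z} → ¬ x ≈ 0# → x * y ≈ x * z → y ≈ z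
  *-cancelˡ {x} {y} {z} x≉0 xy≈xz with inverse x x≉0
  ... | x⁻¹ , xx⁻¹≈1 = begin
    y              ≈⟨ x⁻¹*x*u≈u y ⟨
    x⁻¹ * x * y    ≈⟨ *-assoc x⁻¹ x y ⟩
    x⁻¹ * (x * y)  ≈⟨ *-congˡ xy≈xz ⟩
    x⁻¹ * (x * z)  ≈⟨ *-assoc x⁻¹ x z ⟨
    x⁻¹ * x * z    ≈⟨ x⁻¹*x*u≈u z ⟩
    z              ∎
    where
    x⁻¹*x*u≈u : ∀ u → x⁻¹ * x * u ≈ u
    x⁻¹*x*u≈u u = trans (*-congʳ (trans (*-comm x⁻¹ x) xx⁻¹≈1)) (*-identityˡ u)

  *-≉0 : ∀ {x y} → ¬ x ≈ 0# → ¬ y ≈ 0# → ¬ x * y ≈ 0#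
  *-≉0 {x} x≉0 y≉0 xy≈0 = y≉0 (*-cancelˡ x≉0 (trans xy≈0 (sym (zeroʳ x))))

module Polynomials {ℓ₁ ℓ₂} (K : CommutativeRing ℓ₁ ℓ₂) where
  open CommutativeRing K
  open PolyOps K

  quadratic : Carrier → Carrier → Carrier → Poly
  quadratic q r s zero                = s
  quadratic q r s (suc zero)          = r
  quadratic q r s (suc (suc zero))    = q
  quadratic q r s (suc (suc (suc _))) = 0#

  monicCubic : Carrier → Carrier → Carrier → Poly
  monicCubic a₂ a₁ a₀ zero                      = a₀
  monicCubic a₂ a₁ a₀ (suc zero)                = a₁
  monicCubic a₂ a₁ a₀ (suc (suc zero))          = a₂
  monicCubic a₂ a₁ a₀ (suc (suc (suc zero)))    = 1#
  monicCubic a₂ a₁ a₀ (suc (suc (suc (suc _)))) = 0#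

  ≋-linear : ∀ {p} → (∀ n → 1 < n → p n ≈ 0#) → p ≋ linear (p 1) (p 0)
  ≋-linear p≈0 zero          = refl
  ≋-linear p≈0 (suc zero)    = refl
  ≋-linear p≈0 (suc (suc n)) = p≈0 (suc (suc n)) (s≤s (s≤s z≤n))

  ≋-quadratic : ∀ {p} → (∀ n → 2 < n → p n ≈ 0#) → p ≋ quadratic (p 2) (p 1) (p 0)
  ≋-quadratic p≈0 zero                = refl
  ≋-quadratic p≈0 (suc zero)          = refl
  ≋-quadratic p≈0 (suc (suc zero))    = refl
  ≋-quadratic p≈0 (suc (suc (suc n))) = p≈0 (suc (suc (suc n))) (s≤s (s≤s (s≤s z≤n)))

  ≋-monicCubic : ∀ {p} → MonicOfDegree p 3 → p ≋ monicCubic (p 2) (p 1) (p 0)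
  ≋-monicCubic (p₃≈1 , p≈0) zero                      = refl
  ≋-monicCubic (p₃≈1 , p≈0) (suc zero)                = refl
  ≋-monicCubic (p₃≈1 , p≈0) (suc (suc zero))          = refl
  ≋-monicCubic (p₃≈1 , p≈0) (suc (suc (suc zero)))    = p₃≈1
  ≋-monicCubic (p₃≈1 , p≈0) (suc (suc (suc (suc n)))) =
    p≈0 (suc (suc (suc (suc n)))) (s≤s (s≤s (s≤s (s≤s z≤n))))

  ≋-refl : ∀ {p} → p ≋ p
  ≋-refl n = refl

  ≋-sym : ∀ {p q} → p ≋ q → q ≋ p
  ≋-sym p≋q n = sym (p≋q n)

  ≋-trans : ∀ {p q r} → p ≋ q → q ≋ r → p ≋ r
  ≋-trans p≋q q≋r n = trans (p≋q n) (q≋r n)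

  sumUpTo-cong : ∀ {f g} n → (∀ i → f i ≈ g i) → sumUpTo f n ≈ sumUpTo g n
  sumUpTo-cong zero    f≈g = refl
  sumUpTo-cong (suc n) f≈g = +-cong (sumUpTo-cong n f≈g) (f≈g n)

  ⊕-cong : ∀ {p p′ q q′} → p ≋ p′ → q ≋ q′ → (p ⊕ q) ≋ (p′ ⊕ q′)
  ⊕-cong p≋p′ q≋q′ n = +-cong (p≋p′ n) (q≋q′ n)

  ⊗-cong : ∀ {p p′ q q′} → p ≋ p′ → q ≋ q′ → (p ⊗ q) ≋ (p′ ⊗ q′)
  ⊗-cong p≋p′ q≋q′ n = sumUpTo-cong (suc n) (λ i → *-cong (p≋p′ i) (q≋q′ (n ∸ i)))

  ⊖-cong : ∀ {p q} → p ≋ q → (⊖ p) ≋ (⊖ q)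
  ⊖-cong p≋q n = -‿cong (p≋q n)

  evalDeg-cong : ∀ {p q} d x → p ≋ q → evalDeg d p x ≈ evalDeg d q x
  evalDeg-cong d x p≋q = sumUpTo-cong (suc d) (λ i → *-congʳ (p≋q i))

  sumUpTo-≈0 : ∀ {f} n → (∀ i → i < n → f i ≈ 0#) → sumUpTo f n ≈ 0#
  sumUpTo-≈0 zero    f≈0 = refl
  sumUpTo-≈0 (suc n) f≈0 = trans
    (+-cong (sumUpTo-≈0 n (λ i i<n → f≈0 i (ℕ.m<n⇒m<1+n i<n))) (f≈0 n ℕ.≤-refl))
    (+-identityʳ 0#)

  sumUpTo-single : ∀ {f} n k → k < n → (∀ i → i < n → i ≢ k → f i ≈ 0#) → sumUpTo f n ≈ f k
  sumUpTo-single (suc n) k k<1+n f≈0 with k ℕ.≟ n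
  ... | yes ≡.refl = trans
    (+-congʳ (sumUpTo-≈0 n (λ i i<n → f≈0 i (ℕ.m<n⇒m<1+n i<n) (ℕ.<⇒≢ i<n))))
    (+-identityˡ _)
  ... | no k≢n = trans
    (+-cong (sumUpTo-single n k (ℕ.≤∧≢⇒< (ℕ.s≤s⁻¹ k<1+n) k≢n) (λ i i<n → f≈0 i (ℕ.m<n⇒m<1+n i<n)))
            (f≈0 n ℕ.≤-refl (k≢n ∘ ≡.sym)))
    (+-identityʳ _)

  ⊗-top-coefficient : ∀ {p q} n k → (∀ i → n < i → p i ≈ 0#) → (∀ j → k < j → q j ≈ 0#) →
                      (p ⊗ q) (n ℕ.+ k) ≈ p n * q k
  ⊗-top-coefficient {p} {q} n k p≈0 q≈0 = trans
    (sumUpTo-single (suc (n ℕ.+ k)) n (s≤s (ℕ.m≤m+n n k)) other-terms≈0)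
    (*-congˡ (reflexive (≡.cong q (ℕ.m+n∸m≡n n k))))
    where
    other-terms≈0 : ∀ i → i < suc (n ℕ.+ k) → i ≢ n → p i * q (n ℕ.+ k ∸ i) ≈ 0#
    other-terms≈0 i _ i≢n with ℕ.<-cmp i n
    ... | tri< i<n _ _ = trans (*-congˡ (q≈0 _ k<n+k∸i)) (zeroʳ _)
      where
      k<n+k∸i : k < n ℕ.+ k ∸ i
      k<n+k∸i = ≡.subst (k <_) (≡.sym (ℕ.+-∸-comm k (ℕ.<⇒≤ i<n))) (ℕ.+-monoˡ-< k (ℕ.m<n⇒0<n∸m i<n))
    ... | tri≈ _ i≡n _ = contradiction i≡n i≢n
    ... | tri> _ _ n<i = trans (*-congʳ (p≈0 i n<i)) (zeroˡ _)

  module _ (isField : IsField K) where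
    open FieldProperties K isField

    quotient-degree : ∀ {p q} m k → IsPolynomial p → HasDegree q k →
                      (∀ n → m ℕ.+ k < n → (p ⊗ q) n ≈ 0#) → ∀ n → m < n → p n ≈ 0#
    quotient-degree {p} {q} m k (N , p≈0) (qₖ≉0 , q≈0) pq≈0 n m<n =
      downwards (suc N) n m<n (ℕ.m≤n+m (suc N) n)
      where
      -- Downward induction from the support of p: if p vanishes above n then
      -- p n * q k is the top coefficient of p ⊗ q.
      downwards : ∀ t n → m < n → N < n ℕ.+ t → p n ≈ 0#
      downwards zero    n _   N<n     = p≈0 n (≡.subst (N <_) (ℕ.+-identityʳ n) N<n)
      downwards (suc t) n m<n N<n+1+t = *-cancelˡ qₖ≉0 (begin
        q k * p n          ≈⟨ *-comm _ _ ⟩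
        p n * q k          ≈⟨ ⊗-top-coefficient n k above q≈0 ⟨
        (p ⊗ q) (n ℕ.+ k)  ≈⟨ pq≈0 _ (ℕ.+-monoˡ-< k m<n) ⟩
        0#                 ≈⟨ zeroʳ _ ⟨
        q k * 0#           ∎)
        where
        open import Relation.Binary.Reasoning.Setoid setoid
        above : ∀ i → n < i → p i ≈ 0#
        above i n<i = downwards t i (ℕ.<-trans m<n n<i)
          (ℕ.<-≤-trans (≡.subst (N <_) (ℕ.+-suc n t) N<n+1+t) (ℕ.+-monoˡ-≤ t n<i))

module Solver {ℓ₁ ℓ₂} (R : CommutativeRing ℓ₁ ℓ₂) where
  open CommutativeRing R
  open import Algebra.Properties.Ring ring
    using (-‿involutive; -0#≈0#; -‿distribˡ-*; -‿distribʳ-*; -‿+-comm; xyx⁻¹≈y; x≈y⇒x∙y⁻¹≈ε)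
  open import Algebra.Properties.Semiring.Mult.TCOptimised semiring
    using (1+×; ×-homo-+; ×1-homo-*) renaming (_×_ to _×′_)
  open import Relation.Binary.Reasoning.Setoid setoid

  -- The ring solver only sees cancellations if coefficients have decidable
  -- equality, so it is run with integer coefficients, mapped into R by fromℤ.
  -- With the optimised multiplication _×′_, fromℤ 0ℤ and fromℤ 1ℤ compute to
  -- 0# and 1#, so con 0ℤ and con 1ℤ denote 0# and 1# definitionally.
  fromℤ : ℤ → Carrier
  fromℤ (Int.+ n)    = n ×′ 1#
  fromℤ Int.-[1+ n ] = - (suc n ×′ 1#)

  fromℤ-⊖ : ∀ m n → fromℤ (m Int.⊖ n) ≈ m ×′ 1# - n ×′ 1#
  fromℤ-⊖ m zero = begin
    fromℤ (m Int.⊖ 0)  ≡⟨ ≡.cong fromℤ (Intₚ.⊖-≥ {m} z≤n) ⟩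
    m ×′ 1#            ≈⟨ +-identityʳ _ ⟨
    m ×′ 1# + 0#       ≈⟨ +-congˡ -0#≈0# ⟨
    m ×′ 1# - 0 ×′ 1#  ∎
  fromℤ-⊖ zero (suc n) = begin
    fromℤ (0 Int.⊖ suc n)  ≡⟨ ≡.cong fromℤ (Intₚ.⊖-≤ {n = suc n} z≤n) ⟩
    - (suc n ×′ 1#)        ≈⟨ +-identityˡ _ ⟨
    0 ×′ 1# - suc n ×′ 1#  ∎
  fromℤ-⊖ (suc m) (suc n) = begin
    fromℤ (suc m Int.⊖ suc n)          ≡⟨ ≡.cong fromℤ (Intₚ.[1+m]⊖[1+n]≡m⊖n m n) ⟩
    fromℤ (m Int.⊖ n)                  ≈⟨ fromℤ-⊖ m n ⟩
    m ×′ 1# - n ×′ 1#                  ≈⟨ +-congʳ (xyx⁻¹≈y 1# (m ×′ 1#)) ⟨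
    1# + m ×′ 1# - 1# - n ×′ 1#        ≈⟨ +-assoc _ _ _ ⟩
    1# + m ×′ 1# + (- 1# - n ×′ 1#)    ≈⟨ +-congˡ (-‿+-comm 1# (n ×′ 1#)) ⟩
    1# + m ×′ 1# - (1# + n ×′ 1#)      ≈⟨ +-cong (1+× m 1#) (-‿cong (1+× n 1#)) ⟨
    suc m ×′ 1# - suc n ×′ 1#          ∎

  fromℤ-+ : ∀ i j → fromℤ (i +ℤ j) ≈ fromℤ i + fromℤ j
  fromℤ-+ Int.-[1+ m ] Int.-[1+ n ] = begin
    - (suc (suc (m ℕ.+ n)) ×′ 1#)  ≡⟨ ≡.cong (λ k → - (suc k ×′ 1#)) (ℕ.+-suc m n) ⟨
    - ((suc m ℕ.+ suc n) ×′ 1#)    ≈⟨ -‿cong (×-homo-+ 1# (suc m) (suc n)) ⟩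
    - (suc m ×′ 1# + suc n ×′ 1#)  ≈⟨ -‿+-comm _ _ ⟨
    - (suc m ×′ 1#) - suc n ×′ 1#  ∎
  fromℤ-+ Int.-[1+ m ] (Int.+ n)    = trans (fromℤ-⊖ n (suc m)) (+-comm _ _)
  fromℤ-+ (Int.+ m)    Int.-[1+ n ] = fromℤ-⊖ m (suc n)
  fromℤ-+ (Int.+ m)    (Int.+ n)    = ×-homo-+ 1# m n

  fromℤ-neg : ∀ i → fromℤ (Int.- i) ≈ - fromℤ i
  fromℤ-neg Int.-[1+ n ]  = sym (-‿involutive _)
  fromℤ-neg (Int.+ zero)  = sym -0#≈0#
  fromℤ-neg (Int.+ suc n) = refl

  signed : Sign → Carrier → Carrier
  signed Sign.+ x = x
  signed Sign.- x = - x

  fromℤ-◃ : ∀ s n → fromℤ (s Int.◃ n) ≈ signed s (n ×′ 1#)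
  fromℤ-◃ Sign.- zero    = sym -0#≈0#
  fromℤ-◃ Sign.+ zero    = refl
  fromℤ-◃ Sign.- (suc n) = refl
  fromℤ-◃ Sign.+ (suc n) = refl

  fromℤ-signAbs : ∀ i → fromℤ i ≈ signed (Int.sign i) (Int.∣ i ∣ ×′ 1#)
  fromℤ-signAbs (Int.+ n)    = refl
  fromℤ-signAbs Int.-[1+ n ] = refl

  signed-cong : ∀ s {x y} → x ≈ y → signed s x ≈ signed s y
  signed-cong Sign.+ x≈y = x≈y
  signed-cong Sign.- x≈y = -‿cong x≈y

  signed-* : ∀ s t x y → signed (s Sign.* t) (x * y) ≈ signed s x * signed t y
  signed-* Sign.+ Sign.+ x y = refl
  signed-* Sign.+ Sign.- x y = -‿distribʳ-* x y
  signed-* Sign.- Sign.+ x y = -‿distribˡ-* x y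
  signed-* Sign.- Sign.- x y = begin
    x * y          ≈⟨ -‿involutive _ ⟨
    - - (x * y)    ≈⟨ -‿cong (-‿distribʳ-* x y) ⟩
    - (x * - y)    ≈⟨ -‿distribˡ-* x (- y) ⟩
    - x * - y      ∎

  fromℤ-* : ∀ i j → fromℤ (i Int.* j) ≈ fromℤ i * fromℤ j
  fromℤ-* i j = begin
    fromℤ (s Sign.* t Int.◃ m ℕ.* n)         ≈⟨ fromℤ-◃ (s Sign.* t) (m ℕ.* n) ⟩
    signed (s Sign.* t) ((m ℕ.* n) ×′ 1#)    ≈⟨ signed-cong (s Sign.* t) (×1-homo-* m n) ⟩
    signed (s Sign.* t) (m ×′ 1# * n ×′ 1#)  ≈⟨ signed-* s t _ _ ⟩
    signed s (m ×′ 1#) * signed t (n ×′ 1#)  ≈⟨ *-cong (fromℤ-signAbs i) (fromℤ-signAbs j) ⟨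
    fromℤ i * fromℤ j                        ∎
    where
    s t : Sign
    s = Int.sign i
    t = Int.sign j
    m n : ℕ
    m = Int.∣ i ∣
    n = Int.∣ j ∣

  almostCommutativeRing : AlmostCommutativeRing ℓ₁ ℓ₂
  almostCommutativeRing = fromCommutativeRing R

  fromℤ-homomorphism : Int.+-*-rawRing -Raw-AlmostCommutative⟶ almostCommutativeRing
  fromℤ-homomorphism = record
    { ⟦_⟧ = fromℤ ; +-homo = fromℤ-+ ; *-homo = fromℤ-* ; -‿homo = fromℤ-neg
    ; 0-homo = refl ; 1-homo = refl }

  fromℤ-≟ : ∀ i j → Maybe (fromℤ i ≈ fromℤ j)
  fromℤ-≟ i j with i Int.≟ j
  ... | yes ≡.refl = just refl
  ... | no _       = nothing

  open import Algebra.Solver.Ring Int.+-*-rawRing almostCommutativeRing fromℤ-homomorphism fromℤ-≟ public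

  -- Copies on solver syntax of the polynomial operations of PolyOps and of
  -- quadratic and monicCubic: ⟦_⟧ of a copy computes to the original, so the
  -- solver can normalise coefficients and values of explicit polynomials.
  module _ {m : ℕ} where
    infixl 6 _⊕ₛ_
    infixl 7 _⊗ₛ_

    sumUpToₛ : (ℕ → Polynomial m) → ℕ → Polynomial m
    sumUpToₛ f zero    = con Int.0ℤ
    sumUpToₛ f (suc n) = sumUpToₛ f n :+ f n

    _⊕ₛ_ _⊗ₛ_ : (ℕ → Polynomial m) → (ℕ → Polynomial m) → ℕ → Polynomial m
    (p ⊕ₛ q) n = p n :+ q n
    (p ⊗ₛ q) n = sumUpToₛ (λ i → p i :* q (n ∸ i)) (suc n)

    ⊖ₛ_ : (ℕ → Polynomial m) → ℕ → Polynomial m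
    (⊖ₛ p) n = :- p n

    powₛ : Polynomial m → ℕ → Polynomial m
    powₛ x zero    = con Int.1ℤ
    powₛ x (suc n) = powₛ x n :* x

    evalDegₛ : ℕ → (ℕ → Polynomial m) → Polynomial m → Polynomial m
    evalDegₛ d p x = sumUpToₛ (λ i → p i :* powₛ x i) (suc d)

    linearₛ : Polynomial m → Polynomial m → ℕ → Polynomial m
    linearₛ a b zero          = b
    linearₛ a b (suc zero)    = a
    linearₛ a b (suc (suc _)) = con Int.0ℤ

    quadraticₛ : Polynomial m → Polynomial m → Polynomial m → ℕ → Polynomial m
    quadraticₛ q r s zero                = s
    quadraticₛ q r s (suc zero)          = r
    quadraticₛ q r s (suc (suc zero))    = q
    quadraticₛ q r s (suc (suc (suc _))) = con Int.0ℤ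

    monicCubicₛ : Polynomial m → Polynomial m → Polynomial m → ℕ → Polynomial m
    monicCubicₛ a₂ a₁ a₀ zero                      = a₀
    monicCubicₛ a₂ a₁ a₀ (suc zero)                = a₁
    monicCubicₛ a₂ a₁ a₀ (suc (suc zero))          = a₂
    monicCubicₛ a₂ a₁ a₀ (suc (suc (suc zero)))    = con Int.1ℤ
    monicCubicₛ a₂ a₁ a₀ (suc (suc (suc (suc _)))) = con Int.0ℤ

  infixl 4 _+₀_
  infix  5 _·_

  vanishing : ∀ {x y} → x ≈ y → x - y ≈ 0#
  vanishing = x≈y⇒x∙y⁻¹≈ε

  _·_ : ∀ a {x y} → x ≈ y → a * (x - y) ≈ 0#
  a · x≈y = trans (*-congˡ (vanishing x≈y)) (zeroʳ a)

  _+₀_ : ∀ {x y} → x ≈ 0# → y ≈ 0# → x + y ≈ 0#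
  x≈0 +₀ y≈0 = trans (+-cong x≈0 y≈0) (+-identityʳ 0#)

  -- Every algebraic step below is a certificate: the solver checks x ≈ y + z
  -- where z = c₁ * (l₁ - r₁) + … for hypotheses lᵢ ≈ rᵢ, which make z vanish.
  combine : ∀ {x y z} → x ≈ y + z → z ≈ 0# → x ≈ y
  combine x≈y+z z≈0 = trans x≈y+z (trans (+-congˡ z≈0) (+-identityʳ _))

infixl 10 _⁺ _⁺² _⁺³ _⁺⁴ _⁺⁵ _⁺⁶

_⁺ _⁺² _⁺³ _⁺⁴ _⁺⁵ _⁺⁶ : ℤ → ℤ
h ⁺  = h +ℤ Int.1ℤ
h ⁺² = h ⁺ ⁺
h ⁺³ = h ⁺² ⁺
h ⁺⁴ = h ⁺³ ⁺
h ⁺⁵ = h ⁺⁴ ⁺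
h ⁺⁶ = h ⁺⁵ ⁺

module ContinuedFraction {ℓ₁ ℓ₂} (K : CommutativeRing ℓ₁ ℓ₂)
  (A₂ A₁ A₀ v w : CommutativeRing.Carrier K) (d e q r s b c : ℤ → CommutativeRing.Carrier K) where

  open CommutativeRing K
  open PolyOps K
  open Polynomials K
  open Solver K

  P Q a : ℤ → Poly
  P h = linear (d h) (d h * e h)
  Q h = quadratic (q h) (r h) (s h)
  a h = linear (b h) (c h)

  A R : Poly
  A = monicCubic A₂ A₁ A₀
  R = linear (- v) (v * w)

  P̂ Q̂ â : ℤ → Carrier → Carrier
  P̂ h x = d h * (x + e h)
  Q̂ h x = (q h * x + r h) * x + s h
  â h x = b h * x + c h

  Â : Carrier → Carrier
  Â x = ((x + A₂) * x + A₁) * x + A₀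

  -- Q h + P (h ⁺) * a (h ⁺) turns out to be this constant.
  k : ℤ → Carrier
  k h = s h + d (h ⁺) * e (h ⁺) * c (h ⁺)

  module _ {m : ℕ} where
    Pₛ : Polynomial m → Polynomial m → ℕ → Polynomial m
    Pₛ d e = linearₛ d (d :* e)

    Aₛ : Polynomial m → Polynomial m → Polynomial m → ℕ → Polynomial m
    Aₛ = monicCubicₛ

    Rₛ : Polynomial m → Polynomial m → ℕ → Polynomial m
    Rₛ v w = linearₛ (:- v) (v :* w)

    P̂ₛ : Polynomial m → Polynomial m → Polynomial m → Polynomial m
    P̂ₛ d e x = d :* (x :+ e)

    Q̂ₛ : Polynomial m → Polynomial m → Polynomial m → Polynomial m → Polynomial m
    Q̂ₛ q r s x = (q :* x :+ r) :* x :+ s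

    âₛ : Polynomial m → Polynomial m → Polynomial m → Polynomial m
    âₛ b c x = b :* x :+ c

    Âₛ : Polynomial m → Polynomial m → Polynomial m → Polynomial m → Polynomial m
    Âₛ A₂ A₁ A₀ x = ((x :+ A₂) :* x :+ A₁) :* x :+ A₀

    partial-quotientₗ : (d e d′ e′ A₂ A₁ A₀ : Polynomial m) → ℕ → Polynomial m
    partial-quotientₗ d e d′ e′ A₂ A₁ A₀ = Pₛ d e ⊕ₛ Pₛ d′ e′ ⊕ₛ Aₛ A₂ A₁ A₀

    partial-quotientᵣ : (b c q r s : Polynomial m) → ℕ → Polynomial m
    partial-quotientᵣ b c q r s = linearₛ b c ⊗ₛ quadraticₛ q r s

    norm-equationₗ : (q r s q′ r′ s′ : Polynomial m) → ℕ → Polynomial m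
    norm-equationₗ q r s q′ r′ s′ = ⊖ₛ (quadraticₛ q r s ⊗ₛ quadraticₛ q′ r′ s′)

    norm-equationᵣ : (v w d′ e′ A₂ A₁ A₀ : Polynomial m) → ℕ → Polynomial m
    norm-equationᵣ v w d′ e′ A₂ A₁ A₀ = ⊖ₛ Rₛ v w ⊕ₛ Pₛ d′ e′ ⊗ₛ (Aₛ A₂ A₁ A₀ ⊕ₛ Pₛ d′ e′)

  evalDeg-A : ∀ x → evalDeg 3 A x ≈ Â x
  evalDeg-A = solve 4 (λ A₂ A₁ A₀ x → evalDegₛ 3 (Aₛ A₂ A₁ A₀) x := Âₛ A₂ A₁ A₀ x) refl A₂ A₁ A₀

  module Relations
    (partial-quotient : ∀ h → ((P h ⊕ P (h ⁺)) ⊕ A) ≋ (a h ⊗ Q h))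
    (norm-equation    : ∀ h → (⊖ (Q h ⊗ Q (h ⁺))) ≋ ((⊖ R) ⊕ (P (h ⁺) ⊗ (A ⊕ P (h ⁺)))))
    where

    b*q≈1 : ∀ h → b h * q h ≈ 1#
    b*q≈1 h = combine
      (solve 12 (λ d e d′ e′ A₂ A₁ A₀ b c q r s →
        b :* q := con Int.1ℤ
          :+ (partial-quotientᵣ b c q r s 3 :- partial-quotientₗ d e d′ e′ A₂ A₁ A₀ 3))
        refl (d h) (e h) (d (h ⁺)) (e (h ⁺)) A₂ A₁ A₀ (b h) (c h) (q h) (r h) (s h))
      (vanishing (sym (partial-quotient h 3)))

    q*q⁺≈-d⁺ : ∀ h → q h * q (h ⁺) ≈ - d (h ⁺)
    q*q⁺≈-d⁺ h = combine
      (solve 13 (λ q r s q′ r′ s′ v w d′ e′ A₂ A₁ A₀ →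
        q :* q′ := :- d′
          :+ (norm-equationᵣ v w d′ e′ A₂ A₁ A₀ 4 :- norm-equationₗ q r s q′ r′ s′ 4))
        refl (q h) (r h) (s h) (q (h ⁺)) (r (h ⁺)) (s (h ⁺)) v w (d (h ⁺)) (e (h ⁺)) A₂ A₁ A₀)
      (vanishing (sym (norm-equation h 4)))

    Q+P⁺a⁺-coefficient₂≈0 : ∀ h → q h + d (h ⁺) * b (h ⁺) ≈ 0#
    Q+P⁺a⁺-coefficient₂≈0 h = combine
      (solve 4 (λ q b′ q′ d′ →
        q :+ d′ :* b′ := con Int.0ℤ
          :+ (:- q :* (b′ :* q′ :- con Int.1ℤ) :+ b′ :* (q :* q′ :- :- d′)))
        refl (q h) (b (h ⁺)) (q (h ⁺)) (d (h ⁺)))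
      ((- q h) · b*q≈1 (h ⁺) +₀ b (h ⁺) · q*q⁺≈-d⁺ h)

    Q+P⁺a⁺-coefficient₁≈0 : ∀ h → r h + d (h ⁺) * (c (h ⁺) + e (h ⁺) * b (h ⁺)) ≈ 0#
    Q+P⁺a⁺-coefficient₁≈0 h = combine
      (solve 17 (λ q r s q′ r′ s′ v w d′ e′ A₂ A₁ A₀ b′ c′ d″ e″ →
        r :+ d′ :* (c′ :+ e′ :* b′) := con Int.0ℤ
          :+ ( b′ :* (norm-equationᵣ v w d′ e′ A₂ A₁ A₀ 3 :- norm-equationₗ q r s q′ r′ s′ 3)
             :+ b′ :* d′ :* ( partial-quotientᵣ b′ c′ q′ r′ s′ 2
                            :- partial-quotientₗ d′ e′ d″ e″ A₂ A₁ A₀ 2)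
             :+ :- (r :+ d′ :* c′) :* (b′ :* q′ :- con Int.1ℤ)
             :+ :- (b′ :* r′) :* (q :+ d′ :* b′ :- con Int.0ℤ)))
        refl (q h) (r h) (s h) (q (h ⁺)) (r (h ⁺)) (s (h ⁺)) v w (d (h ⁺)) (e (h ⁺)) A₂ A₁ A₀
             (b (h ⁺)) (c (h ⁺)) (d (h ⁺²)) (e (h ⁺²)))
      ( b (h ⁺) · sym (norm-equation h 3)
      +₀ b (h ⁺) * d (h ⁺) · sym (partial-quotient (h ⁺) 2)
      +₀ (- (r h + d (h ⁺) * c (h ⁺))) · b*q≈1 (h ⁺)
      +₀ (- (b (h ⁺) * r (h ⁺))) · Q+P⁺a⁺-coefficient₂≈0 h)

    k*q⁺≈d⁺*d⁺² : ∀ h → k h * q (h ⁺) ≈ d (h ⁺) * d (h ⁺²)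
    k*q⁺≈d⁺*d⁺² h = combine
      (solve 17 (λ q r s q′ r′ s′ v w d′ e′ A₂ A₁ A₀ b′ c′ d″ e″ →
        (s :+ d′ :* e′ :* c′) :* q′ := d′ :* d″
          :+ ( (norm-equationᵣ v w d′ e′ A₂ A₁ A₀ 2 :- norm-equationₗ q r s q′ r′ s′ 2)
             :+ d′ :* ( partial-quotientᵣ b′ c′ q′ r′ s′ 1
                      :- partial-quotientₗ d′ e′ d″ e″ A₂ A₁ A₀ 1)
             :+ d′ :* e′ :* ( partial-quotientᵣ b′ c′ q′ r′ s′ 2
                            :- partial-quotientₗ d′ e′ d″ e″ A₂ A₁ A₀ 2)
             :+ :- r′ :* (r :+ d′ :* (c′ :+ e′ :* b′) :- con Int.0ℤ)
             :+ :- s′ :* (q :+ d′ :* b′ :- con Int.0ℤ)))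
        refl (q h) (r h) (s h) (q (h ⁺)) (r (h ⁺)) (s (h ⁺)) v w (d (h ⁺)) (e (h ⁺)) A₂ A₁ A₀
             (b (h ⁺)) (c (h ⁺)) (d (h ⁺²)) (e (h ⁺²)))
      ( vanishing (sym (norm-equation h 2))
      +₀ d (h ⁺) · sym (partial-quotient (h ⁺) 1)
      +₀ d (h ⁺) * e (h ⁺) · sym (partial-quotient (h ⁺) 2)
      +₀ (- r (h ⁺)) · Q+P⁺a⁺-coefficient₁≈0 h
      +₀ (- s (h ⁺)) · Q+P⁺a⁺-coefficient₂≈0 h)

    evaluate-partial-quotient : ∀ h x → â h x * Q̂ h x ≈ P̂ h x + P̂ (h ⁺) x + Â x
    evaluate-partial-quotient h x = combine
      (solve 13 (λ b c q r s d e d′ e′ A₂ A₁ A₀ x →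
        âₛ b c x :* Q̂ₛ q r s x := P̂ₛ d e x :+ P̂ₛ d′ e′ x :+ Âₛ A₂ A₁ A₀ x
          :+ ( evalDegₛ 3 (partial-quotientᵣ b c q r s) x
             :- evalDegₛ 3 (partial-quotientₗ d e d′ e′ A₂ A₁ A₀) x))
        refl (b h) (c h) (q h) (r h) (s h) (d h) (e h) (d (h ⁺)) (e (h ⁺)) A₂ A₁ A₀ x)
      (vanishing (evalDeg-cong 3 x (≋-sym (partial-quotient h))))

    evaluate-norm-equation : ∀ h x → Q̂ h x * Q̂ (h ⁺) x ≈ v * (w - x) - P̂ (h ⁺) x * (Â x + P̂ (h ⁺) x)
    evaluate-norm-equation h x = combine
      (solve 14 (λ q r s q′ r′ s′ v w d′ e′ A₂ A₁ A₀ x →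
        Q̂ₛ q r s x :* Q̂ₛ q′ r′ s′ x := v :* (w :- x) :- P̂ₛ d′ e′ x :* (Âₛ A₂ A₁ A₀ x :+ P̂ₛ d′ e′ x)
          :+ ( evalDegₛ 4 (norm-equationᵣ v w d′ e′ A₂ A₁ A₀) x
             :- evalDegₛ 4 (norm-equationₗ q r s q′ r′ s′) x))
        refl (q h) (r h) (s h) (q (h ⁺)) (r (h ⁺)) (s (h ⁺)) v w (d (h ⁺)) (e (h ⁺)) A₂ A₁ A₀ x)
      (vanishing (evalDeg-cong 4 x (≋-sym (norm-equation h))))

    evaluate-Q+P⁺a⁺ : ∀ h x → Q̂ h x + P̂ (h ⁺) x * â (h ⁺) x ≈ k h
    evaluate-Q+P⁺a⁺ h x = combine
      (solve 8 (λ q r s d′ e′ b′ c′ x →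
        Q̂ₛ q r s x :+ P̂ₛ d′ e′ x :* âₛ b′ c′ x := s :+ d′ :* e′ :* c′
          :+ ( x :* x :* (q :+ d′ :* b′ :- con Int.0ℤ)
             :+ x :* (r :+ d′ :* (c′ :+ e′ :* b′) :- con Int.0ℤ)))
        refl (q h) (r h) (s h) (d (h ⁺)) (e (h ⁺)) (b (h ⁺)) (c (h ⁺)) x)
      (x * x · Q+P⁺a⁺-coefficient₂≈0 h +₀ x · Q+P⁺a⁺-coefficient₁≈0 h)

    evaluate-kQ⁺ : ∀ h x → k h * Q̂ (h ⁺) x ≈ v * (w - x) + P̂ (h ⁺) x * P̂ (h ⁺²) x
    evaluate-kQ⁺ h x = combine
      (solve 10 (λ k Q Q′ P′ P″ a′ A v w x →
        k :* Q′ := v :* (w :- x) :+ P′ :* P″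
          :+ ( (Q :* Q′ :- (v :* (w :- x) :- P′ :* (A :+ P′)))
             :+ P′ :* (a′ :* Q′ :- (P′ :+ P″ :+ A))
             :+ :- Q′ :* (Q :+ P′ :* a′ :- k)))
        refl (k h) (Q̂ h x) (Q̂ (h ⁺) x) (P̂ (h ⁺) x) (P̂ (h ⁺²) x) (â (h ⁺) x) (Â x) v w x)
      ( vanishing (evaluate-norm-equation h x)
      +₀ P̂ (h ⁺) x · evaluate-partial-quotient (h ⁺) x
      +₀ (- Q̂ (h ⁺) x) · evaluate-Q+P⁺a⁺ h x)

    k≈q*q⁺*q⁺² : ∀ h → k h ≈ q h * q (h ⁺) * q (h ⁺²)
    k≈q*q⁺*q⁺² h = combine
      (solve 7 (λ k q q′ q″ b′ d′ d″ →
        k := q :* q′ :* q″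
          :+ ( (q :* q′ :* q″ :- k) :* (b′ :* q′ :- con Int.1ℤ)
             :+ b′ :* (k :* q′ :- d′ :* d″)
             :+ b′ :* d″ :* (q :* q′ :- :- d′)
             :+ :- (b′ :* q :* q′) :* (q′ :* q″ :- :- d″)))
        refl (k h) (q h) (q (h ⁺)) (q (h ⁺²)) (b (h ⁺)) (d (h ⁺)) (d (h ⁺²)))
      ( q h * q (h ⁺) * q (h ⁺²) - k h · b*q≈1 (h ⁺)
      +₀ b (h ⁺) · k*q⁺≈d⁺*d⁺² h
      +₀ b (h ⁺) * d (h ⁺²) · q*q⁺≈-d⁺ h
      +₀ (- (b (h ⁺) * q h * q (h ⁺))) · q*q⁺≈-d⁺ (h ⁺))

    -- Evaluate at the root - e (h ⁺²) of P (h ⁺²).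
    k*k⁺≈v[w+e⁺²] : ∀ h → k h * k (h ⁺) ≈ v * (w + e (h ⁺²))
    k*k⁺≈v[w+e⁺²] h = combine
      (solve 9 (λ k k′ Q′ a″ P′ d″ e″ v w →
        k :* k′ := v :* (w :+ e″)
          :+ ( :- k :* (Q′ :+ P̂ₛ d″ e″ (:- e″) :* a″ :- k′)
             :+ (k :* Q′ :- (v :* (w :- :- e″) :+ P′ :* P̂ₛ d″ e″ (:- e″)))))
        refl (k h) (k (h ⁺)) (Q̂ (h ⁺) y) (â (h ⁺²) y) (P̂ (h ⁺) y) (d (h ⁺²)) (e (h ⁺²)) v w)
      ((- k h) · evaluate-Q+P⁺a⁺ (h ⁺) y +₀ vanishing (evaluate-kQ⁺ h y))
      where
      y : Carrier
      y = - e (h ⁺²)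

    k*k⁺≈-d⁺*d⁺²*d⁺³ : ∀ h → k h * k (h ⁺) ≈ - (d (h ⁺) * d (h ⁺²) * d (h ⁺³))
    k*k⁺≈-d⁺*d⁺²*d⁺³ h = combine
      (solve 9 (λ k k′ q q′ q″ q‴ d′ d″ d‴ →
        k :* k′ := :- (d′ :* d″ :* d‴)
          :+ ( k′ :* (k :- q :* q′ :* q″)
             :+ q :* q′ :* q″ :* (k′ :- q′ :* q″ :* q‴)
             :+ q′ :* q″ :* q″ :* q‴ :* (q :* q′ :- :- d′)
             :+ :- (d′ :* q″ :* q‴) :* (q′ :* q″ :- :- d″)
             :+ d′ :* d″ :* (q″ :* q‴ :- :- d‴)))
        refl (k h) (k (h ⁺)) (q h) (q (h ⁺)) (q (h ⁺²)) (q (h ⁺³)) (d (h ⁺)) (d (h ⁺²)) (d (h ⁺³)))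
      ( k (h ⁺) · k≈q*q⁺*q⁺² h
      +₀ q h * q (h ⁺) * q (h ⁺²) · k≈q*q⁺*q⁺² (h ⁺)
      +₀ q (h ⁺) * q (h ⁺²) * q (h ⁺²) * q (h ⁺³) · q*q⁺≈-d⁺ h
      +₀ (- (d (h ⁺) * q (h ⁺²) * q (h ⁺³))) · q*q⁺≈-d⁺ (h ⁺)
      +₀ d (h ⁺) * d (h ⁺²) · q*q⁺≈-d⁺ (h ⁺²))

    v[w+e⁺²]≈-d⁺*d⁺²*d⁺³ : ∀ h → v * (w + e (h ⁺²)) ≈ - (d (h ⁺) * d (h ⁺²) * d (h ⁺³))
    v[w+e⁺²]≈-d⁺*d⁺²*d⁺³ h = trans (sym (k*k⁺≈v[w+e⁺²] h)) (k*k⁺≈-d⁺*d⁺²*d⁺³ h)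

    evaluate-at-w : ∀ h → k h * k (h ⁺) * (Â w + P̂ (h ⁺²) w)
                          ≈ - (P̂ (h ⁺) w * P̂ (h ⁺²) w * P̂ (h ⁺³) w)
    evaluate-at-w h = combine
      (solve 11 (λ k k′ Q′ Q″ a″ P′ P″ P‴ α v w →
        k :* k′ :* (α :+ P″) := :- (P′ :* P″ :* P‴)
          :+ ( :- (k :* k′) :* (a″ :* Q″ :- (P″ :+ P‴ :+ α))
             :+ k :* a″ :* (k′ :* Q″ :- (v :* (w :- w) :+ P″ :* P‴))
             :+ k :* P‴ :* (Q′ :+ P″ :* a″ :- k′)
             :+ :- P‴ :* (k :* Q′ :- (v :* (w :- w) :+ P′ :* P″))))
        refl (k h) (k (h ⁺)) (Q̂ (h ⁺) w) (Q̂ (h ⁺²) w) (â (h ⁺²) w)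
             (P̂ (h ⁺) w) (P̂ (h ⁺²) w) (P̂ (h ⁺³) w) (Â w) v w)
      ( (- (k h * k (h ⁺))) · evaluate-partial-quotient (h ⁺²) w
      +₀ k h * â (h ⁺²) w · evaluate-kQ⁺ (h ⁺) w
      +₀ k h * P̂ (h ⁺³) w · evaluate-Q+P⁺a⁺ (h ⁺) w
      +₀ (- P̂ (h ⁺³) w) · evaluate-kQ⁺ h w)

    d*d*d*[Â+P̂]≈P̂*P̂*P̂ : ∀ h → d (h ⁺) * d (h ⁺²) * d (h ⁺³) * (Â w + P̂ (h ⁺²) w)
                                ≈ P̂ (h ⁺) w * P̂ (h ⁺²) w * P̂ (h ⁺³) w
    d*d*d*[Â+P̂]≈P̂*P̂*P̂ h = combine
      (solve 9 (λ k k′ α p₁ p₂ p₃ d₁ d₂ d₃ →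
        d₁ :* d₂ :* d₃ :* (α :+ p₂) := p₁ :* p₂ :* p₃
          :+ ( :- con Int.1ℤ :* (k :* k′ :* (α :+ p₂) :- :- (p₁ :* p₂ :* p₃))
             :+ (α :+ p₂) :* (k :* k′ :- :- (d₁ :* d₂ :* d₃))))
        refl (k h) (k (h ⁺)) (Â w) (P̂ (h ⁺) w) (P̂ (h ⁺²) w) (P̂ (h ⁺³) w)
             (d (h ⁺)) (d (h ⁺²)) (d (h ⁺³)))
      ((- 1#) · evaluate-at-w h +₀ Â w + P̂ (h ⁺²) w · k*k⁺≈-d⁺*d⁺²*d⁺³ h)

    module _ (isField : IsField K) (d≉0 : ∀ h → ¬ d h ≈ 0#) where
      open FieldProperties K isField

      -- v * P̂ i w = d i * g i, and v[w+e⁺²]≈-d⁺*d⁺²*d⁺³ says g (i ⁺²) ≈ - n i.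
      d-identity : ∀ h → v * v * (d (h ⁺²) * d (h ⁺³) * d (h ⁺³) * d (h ⁺⁴)) - v * v * v * Â w
                         ≈ d (h ⁺) * d (h ⁺²) * d (h ⁺²) * d (h ⁺³) * d (h ⁺³) * d (h ⁺³)
                           * d (h ⁺⁴) * d (h ⁺⁴) * d (h ⁺⁵)
      d-identity h = *-cancelˡ m≉0 (combine
        (solve 11 (λ v w α d₁ d₂ d₃ d₄ d₅ e₂ e₃ e₄ →
          let m  = d₂ :* d₃ :* d₄
              g₃ = v :* (w :+ e₃)
              g₄ = v :* (w :+ e₄)
              n₁ = d₁ :* d₂ :* d₃
              n₂ = d₂ :* d₃ :* d₄
          in m :* (v :* v :* (d₂ :* d₃ :* d₃ :* d₄) :- v :* v :* v :* α)
             := m :* (d₁ :* d₂ :* d₂ :* d₃ :* d₃ :* d₃ :* d₄ :* d₄ :* d₅)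
             :+ ( :- (m :* g₃ :* g₄) :* (v :* (w :+ e₂) :- :- n₁)
                :+ (m :* n₁ :* g₄ :+ m :* v :* v :* d₃) :* (g₃ :- :- n₂)
                :+ :- (m :* n₁ :* n₂) :* (g₄ :- :- (d₃ :* d₄ :* d₅))
                :+ :- (v :* v :* v)
                  :* (m :* (α :+ P̂ₛ d₃ e₃ w) :- P̂ₛ d₂ e₂ w :* P̂ₛ d₃ e₃ w :* P̂ₛ d₄ e₄ w)))
          refl v w (Â w) (d (h ⁺)) (d (h ⁺²)) (d (h ⁺³)) (d (h ⁺⁴)) (d (h ⁺⁵))
               (e (h ⁺²)) (e (h ⁺³)) (e (h ⁺⁴)))
        ( (- (m * g (h ⁺³) * g (h ⁺⁴))) · v[w+e⁺²]≈-d⁺*d⁺²*d⁺³ h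
        +₀ m * n h * g (h ⁺⁴) + m * v * v * d (h ⁺³) · v[w+e⁺²]≈-d⁺*d⁺²*d⁺³ (h ⁺)
        +₀ (- (m * n h * n (h ⁺))) · v[w+e⁺²]≈-d⁺*d⁺²*d⁺³ (h ⁺²)
        +₀ (- (v * v * v)) · d*d*d*[Â+P̂]≈P̂*P̂*P̂ (h ⁺)))
        where
        m : Carrier
        m = d (h ⁺²) * d (h ⁺³) * d (h ⁺⁴)
        m≉0 : ¬ m ≈ 0#
        m≉0 = *-≉0 (*-≉0 (d≉0 (h ⁺²)) (d≉0 (h ⁺³))) (d≉0 (h ⁺⁴))
        g n : ℤ → Carrier
        g i = v * (w + e i)
        n i = d (i ⁺) * d (i ⁺²) * d (i ⁺³)

module TSequences {ℓ₁ ℓ₂} (K : CommutativeRing ℓ₁ ℓ₂) (isField : IsField K) where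
  open CommutativeRing K
  open FieldProperties K isField
  open Solver K

  module TSequence (T d : ℤ → Carrier) (T≉0 : ∀ h → ¬ T h ≈ 0#)
    (T-relation : ∀ h → T (h -ℤ Int.1ℤ) * T (h ⁺) ≈ d h * (T h * T h)) where

    d≉0 : ∀ h → ¬ d h ≈ 0#
    d≉0 h dₕ≈0 = *-≉0 (T≉0 (h -ℤ Int.1ℤ)) (T≉0 (h ⁺))
      (trans (T-relation h) (trans (*-congʳ dₕ≈0) (zeroˡ _)))

    T*T⁺²≈d⁺*T⁺² : ∀ h → T h * T (h ⁺²) ≈ d (h ⁺) * (T (h ⁺) * T (h ⁺))
    T*T⁺²≈d⁺*T⁺² h =
      ≡.subst (λ i → T i * T (h ⁺²) ≈ d (h ⁺) * (T (h ⁺) * T (h ⁺))) (h+1-1≡h h) (T-relation (h ⁺))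
      where
      h+1-1≡h : ∀ h → h +ℤ Int.1ℤ -ℤ Int.1ℤ ≡ h
      h+1-1≡h = ℤ-solve-∀

    -- (T₀ T₄) (T₂ T₂) = (T₀ T₂) (T₂ T₄) = d₁ d₃ (T₁ T₃)²
    T*T⁺⁴≈d*d*d*d*T⁺² : ∀ h → T h * T (h ⁺⁴)
                             ≈ d (h ⁺) * d (h ⁺²) * d (h ⁺²) * d (h ⁺³) * (T (h ⁺²) * T (h ⁺²))
    T*T⁺⁴≈d*d*d*d*T⁺² h = *-cancelˡ (*-≉0 (T≉0 (h ⁺²)) (T≉0 (h ⁺²))) (combine
      (solve 8 (λ t₀ t₁ t₂ t₃ t₄ d₁ d₂ d₃ →
        t₂ :* t₂ :* (t₀ :* t₄) := t₂ :* t₂ :* (d₁ :* d₂ :* d₂ :* d₃ :* (t₂ :* t₂))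
          :+ ( t₂ :* t₄ :* (t₀ :* t₂ :- d₁ :* (t₁ :* t₁))
             :+ d₁ :* (t₁ :* t₁) :* (t₂ :* t₄ :- d₃ :* (t₃ :* t₃))
             :+ d₁ :* d₃ :* (t₁ :* t₃ :+ d₂ :* (t₂ :* t₂)) :* (t₁ :* t₃ :- d₂ :* (t₂ :* t₂))))
        refl (T h) (T (h ⁺)) (T (h ⁺²)) (T (h ⁺³)) (T (h ⁺⁴)) (d (h ⁺)) (d (h ⁺²)) (d (h ⁺³)))
      ( T (h ⁺²) * T (h ⁺⁴) · T*T⁺²≈d⁺*T⁺² h
      +₀ d (h ⁺) * (T (h ⁺) * T (h ⁺)) · T*T⁺²≈d⁺*T⁺² (h ⁺²)
      +₀ d (h ⁺) * d (h ⁺³) * (T (h ⁺) * T (h ⁺³) + d (h ⁺²) * (T (h ⁺²) * T (h ⁺²)))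
         · T*T⁺²≈d⁺*T⁺² (h ⁺)))

    -- (T₀ T₆) (T₂ T₄) = (T₀ T₂) (T₄ T₆) = d₁ d₅ (T₁ T₅)²
    T*T⁺⁶≈d*…*d*T⁺³ : ∀ h → T h * T (h ⁺⁶)
                           ≈ d (h ⁺) * d (h ⁺²) * d (h ⁺²) * d (h ⁺³) * d (h ⁺³) * d (h ⁺³)
                             * d (h ⁺⁴) * d (h ⁺⁴) * d (h ⁺⁵) * (T (h ⁺³) * T (h ⁺³))
    T*T⁺⁶≈d*…*d*T⁺³ h = *-cancelˡ (*-≉0 (d≉0 (h ⁺³)) (*-≉0 (T≉0 (h ⁺³)) (T≉0 (h ⁺³)))) (combine
      (solve 12 (λ t₀ t₁ t₂ t₃ t₄ t₅ t₆ d₁ d₂ d₃ d₄ d₅ →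
        let n = d₂ :* d₃ :* d₃ :* d₄ in
        d₃ :* (t₃ :* t₃) :* (t₀ :* t₆)
          := d₃ :* (t₃ :* t₃) :* (d₁ :* d₂ :* d₂ :* d₃ :* d₃ :* d₃ :* d₄ :* d₄ :* d₅ :* (t₃ :* t₃))
          :+ ( t₄ :* t₆ :* (t₀ :* t₂ :- d₁ :* (t₁ :* t₁))
             :+ d₁ :* (t₁ :* t₁) :* (t₄ :* t₆ :- d₅ :* (t₅ :* t₅))
             :+ :- (t₀ :* t₆) :* (t₂ :* t₄ :- d₃ :* (t₃ :* t₃))
             :+ d₁ :* d₅ :* (t₁ :* t₅ :+ n :* (t₃ :* t₃)) :* (t₁ :* t₅ :- n :* (t₃ :* t₃))))
        refl (T h) (T (h ⁺)) (T (h ⁺²)) (T (h ⁺³)) (T (h ⁺⁴)) (T (h ⁺⁵)) (T (h ⁺⁶))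
             (d (h ⁺)) (d (h ⁺²)) (d (h ⁺³)) (d (h ⁺⁴)) (d (h ⁺⁵)))
      ( T (h ⁺⁴) * T (h ⁺⁶) · T*T⁺²≈d⁺*T⁺² h
      +₀ d (h ⁺) * (T (h ⁺) * T (h ⁺)) · T*T⁺²≈d⁺*T⁺² (h ⁺⁴)
      +₀ (- (T h * T (h ⁺⁶))) · T*T⁺²≈d⁺*T⁺² (h ⁺²)
      +₀ d (h ⁺) * d (h ⁺⁵) * (T (h ⁺) * T (h ⁺⁵) + n * (T (h ⁺³) * T (h ⁺³)))
         · T*T⁺⁴≈d*d*d*d*T⁺² (h ⁺)))
      where
      n : Carrier
      n = d (h ⁺²) * d (h ⁺³) * d (h ⁺³) * d (h ⁺⁴)

    module _ (v α : Carrier)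
      (d-identity : ∀ h → v * v * (d (h ⁺²) * d (h ⁺³) * d (h ⁺³) * d (h ⁺⁴)) - v * v * v * α
                          ≈ d (h ⁺) * d (h ⁺²) * d (h ⁺²) * d (h ⁺³) * d (h ⁺³) * d (h ⁺³)
                            * d (h ⁺⁴) * d (h ⁺⁴) * d (h ⁺⁵))
      where

      recurrence⁺ : ∀ h → T h * T (h ⁺⁶)
                          ≈ v * v * (T (h ⁺) * T (h ⁺⁵)) + - (v * v * v * α * (T (h ⁺³) * T (h ⁺³)))
      recurrence⁺ h = combine
        (solve 9 (λ t₀ t₁ t₃ t₅ t₆ v α n D →
          t₀ :* t₆ := v :* v :* (t₁ :* t₅) :+ :- (v :* v :* v :* α :* (t₃ :* t₃))
            :+ ( (t₀ :* t₆ :- D :* (t₃ :* t₃))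
               :+ :- (v :* v) :* (t₁ :* t₅ :- n :* (t₃ :* t₃))
               :+ :- (t₃ :* t₃) :* (v :* v :* n :- v :* v :* v :* α :- D)))
          refl (T h) (T (h ⁺)) (T (h ⁺³)) (T (h ⁺⁵)) (T (h ⁺⁶)) v α
               (d (h ⁺²) * d (h ⁺³) * d (h ⁺³) * d (h ⁺⁴))
               (d (h ⁺) * d (h ⁺²) * d (h ⁺²) * d (h ⁺³) * d (h ⁺³) * d (h ⁺³)
                 * d (h ⁺⁴) * d (h ⁺⁴) * d (h ⁺⁵)))
        ( vanishing (T*T⁺⁶≈d*…*d*T⁺³ h)
        +₀ (- (v * v)) · T*T⁺⁴≈d*d*d*d*T⁺² (h ⁺)
        +₀ (- (T (h ⁺³) * T (h ⁺³))) · d-identity h)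

      recurrence : ∀ h → T (h -ℤ ℤ.pos 3) * T (h +ℤ ℤ.pos 3)
                         ≈ v * v * (T (h -ℤ ℤ.pos 2) * T (h +ℤ ℤ.pos 2)) + - (v * v * v * α * (T h * T h))
      recurrence h =
        recentre (j⁺≡h-2 h) (j⁺³≡h h) (j⁺⁵≡h+2 h) (j⁺⁶≡h+3 h) (recurrence⁺ (h -ℤ ℤ.pos 3))
        where
        recentre : ∀ {j i₁ i₃ i₅ i₆} → j ⁺ ≡ i₁ → j ⁺³ ≡ i₃ → j ⁺⁵ ≡ i₅ → j ⁺⁶ ≡ i₆ →
                   T j * T (j ⁺⁶)
                     ≈ v * v * (T (j ⁺) * T (j ⁺⁵)) + - (v * v * v * α * (T (j ⁺³) * T (j ⁺³))) →
                   T j * T i₆ ≈ v * v * (T i₁ * T i₅) + - (v * v * v * α * (T i₃ * T i₃))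
        recentre ≡.refl ≡.refl ≡.refl ≡.refl eq = eq

        j⁺≡h-2 : ∀ h → h -ℤ ℤ.pos 3 +ℤ Int.1ℤ ≡ h -ℤ ℤ.pos 2
        j⁺≡h-2 = ℤ-solve-∀
        j⁺³≡h : ∀ h → h -ℤ ℤ.pos 3 +ℤ Int.1ℤ +ℤ Int.1ℤ +ℤ Int.1ℤ ≡ h
        j⁺³≡h = ℤ-solve-∀
        j⁺⁵≡h+2 : ∀ h → h -ℤ ℤ.pos 3 +ℤ Int.1ℤ +ℤ Int.1ℤ +ℤ Int.1ℤ +ℤ Int.1ℤ +ℤ Int.1ℤ ≡ h +ℤ ℤ.pos 2
        j⁺⁵≡h+2 = ℤ-solve-∀
        j⁺⁶≡h+3 : ∀ h → h -ℤ ℤ.pos 3 +ℤ Int.1ℤ +ℤ Int.1ℤ +ℤ Int.1ℤ +ℤ Int.1ℤ +ℤ Int.1ℤ +ℤ Int.1ℤ ≡ h +ℤ ℤ.pos 3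
        j⁺⁶≡h+3 = ℤ-solve-∀

module Normalisation {ℓ₁ ℓ₂} (K : CommutativeRing ℓ₁ ℓ₂) (isField : IsField K) where
  open CommutativeRing K
  open PolyOps K
  open Polynomials K

  module Hypotheses
    (A : Poly) (A-monic : MonicOfDegree A 3) (v w : Carrier) (d e : ℤ → Carrier) (Q a : ℤ → Poly)
    (Q-degree : ∀ h → HasDegree (Q h) 2) (a-polynomial : ∀ h → IsPolynomial (a h))
    (partial-quotient : ∀ h → ((linear (d h) (d h * e h) ⊕ linear (d (h ⁺)) (d (h ⁺) * e (h ⁺))) ⊕ A)
                                ≋ (a h ⊗ Q h))
    (norm-equation : ∀ h → (⊖ (Q h ⊗ Q (h ⁺)))
                             ≋ ((⊖ linear (- v) (v * w))
                                ⊕ (linear (d (h ⁺)) (d (h ⁺) * e (h ⁺))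
                                   ⊗ (A ⊕ linear (d (h ⁺)) (d (h ⁺) * e (h ⁺))))))
    where

    open ContinuedFraction K (A 2) (A 1) (A 0) v w d e
           (λ h → Q h 2) (λ h → Q h 1) (λ h → Q h 0) (λ h → a h 1) (λ h → a h 0)
      using (P; R; Â; evalDeg-A; module Relations) renaming (Q to Q′; a to a′; A to A′)

    A≋A′ : A ≋ A′
    A≋A′ = ≋-monicCubic A-monic

    Q≋Q′ : ∀ h → Q h ≋ Q′ h
    Q≋Q′ h = ≋-quadratic (proj₂ (Q-degree h))

    a≋a′ : ∀ h → a h ≋ a′ h
    a≋a′ h = ≋-linear (quotient-degree isField 1 2 (a-polynomial h) (Q-degree h) λ n 3<n →
      trans (sym (partial-quotient h n)) (P+P⁺+A≈0 n 3<n))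
      where
      P+P⁺+A≈0 : ∀ n → 3 < n → ((P h ⊕ P (h ⁺)) ⊕ A) n ≈ 0#
      P+P⁺+A≈0 1 (s≤s ())
      P+P⁺+A≈0 (suc (suc n)) 3<n =
        trans (+-congʳ (+-identityˡ 0#)) (trans (+-identityˡ _) (proj₂ A-monic _ 3<n))

    partial-quotient′ : ∀ h → ((P h ⊕ P (h ⁺)) ⊕ A′) ≋ (a′ h ⊗ Q′ h)
    partial-quotient′ h =
      ≋-trans (⊕-cong ≋-refl (≋-sym A≋A′)) (≋-trans (partial-quotient h) (⊗-cong (a≋a′ h) (Q≋Q′ h)))

    norm-equation′ : ∀ h → (⊖ (Q′ h ⊗ Q′ (h ⁺))) ≋ ((⊖ R) ⊕ (P (h ⁺) ⊗ (A′ ⊕ P (h ⁺))))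
    norm-equation′ h = ≋-trans (⊖-cong (⊗-cong (≋-sym (Q≋Q′ h)) (≋-sym (Q≋Q′ (h ⁺)))))
      (≋-trans (norm-equation h) (⊕-cong ≋-refl (⊗-cong ≋-refl (⊕-cong {q = P (h ⁺)} A≋A′ ≋-refl))))

    open Relations partial-quotient′ norm-equation′ public using (d-identity)

    evalDeg-A≈Â : evalDeg 3 A w ≈ Â w
    evalDeg-A≈Â = trans (evalDeg-cong 3 w A≋A′) (evalDeg-A w)

mainTheorem4 : ∀ {c ℓ} (K : CommutativeRing c ℓ) → IsField K →
    let open CommutativeRing K
        open PolyOps K
    in (A : Poly) → MonicOfDegree A 3 →
       (v w : Carrier) → ¬ (v ≈ 0#) →
       (d e : ℤ → Carrier) → (Q a : ℤ → Poly) →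
       (∀ h → HasDegree (Q h) 2) →
       (∀ h → IsPolynomial (a h)) →
       (∀ h → ((linear (d h) (d h * e h) ⊕ linear (d (h +ℤ ℤ.pos 1)) (d (h +ℤ ℤ.pos 1) * e (h +ℤ ℤ.pos 1))) ⊕ A)
                ≋ (a h ⊗ Q h)) →
       (∀ h → (⊖ (Q h ⊗ Q (h +ℤ ℤ.pos 1)))
                ≋ ((⊖ linear (- v) (v * w))
                   ⊕ (linear (d (h +ℤ ℤ.pos 1)) (d (h +ℤ ℤ.pos 1) * e (h +ℤ ℤ.pos 1))
                      ⊗ (A ⊕ linear (d (h +ℤ ℤ.pos 1)) (d (h +ℤ ℤ.pos 1) * e (h +ℤ ℤ.pos 1)))))) →
       (T : ℤ → Carrier) → (∀ h → ¬ (T h ≈ 0#)) →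
       (∀ h → (T (h -ℤ ℤ.pos 1) * T (h +ℤ ℤ.pos 1)) ≈ (d h * (T h * T h))) →
       ∀ h → (T (h -ℤ ℤ.pos 3) * T (h +ℤ ℤ.pos 3))
             ≈ ((v * v) * (T (h -ℤ ℤ.pos 2) * T (h +ℤ ℤ.pos 2))
                + (- ((v * v * v) * evalDeg 3 A w * (T h * T h))))
mainTheorem4 K isField A A-monic v w _ d e Q a Q-degree a-polynomial partial-quotient norm-equation
             T T≉0 T-relation =
  recurrence v (evalDeg 3 A w) λ h → trans (+-congˡ (-‿cong (*-congˡ evalDeg-A≈Â))) (d-identity isField d≉0 h)
  where
  open CommutativeRing K
  open PolyOps K using (evalDeg)
  open TSequences K isField
  open TSequence T d T≉0 T-relation
  open Normalisation K isField
  open Hypotheses A A-monic v w d e Q a Q-degree a-polynomial partial-quotient norm-equation
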